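{- Let $G$ be a weighted forest and let $S$ be a querying strategy that, as long as the residual graph is nonempty, always queries an edge which is pendant in the current residual graph. Then for every realization $\sigma\sim G$, $|M(S,G)(\sigma)|=\mu(\sigma)$, where $\mu(\sigma)$ is the size of a maximum matching in $\sigma$.
   Context: Query-commit problem. A weighted graph is $G=(V,E,p)$ with $p:E\to(0,1]$; isolated nodes are ignored. A realization $\sigma\sim G$ is the random subgraph containing each edge $e$ independently with probability $p_e$. A querying strategy starts with the empty matching and residual graph $R=G$; each step it queries an edge $e$ of $R$; if $e\in\sigma$, $e$ is added to the matching and $R$ becomes $R\setminus N(e)$ (all edges sharing an endpoint with $e$ removed), otherwise $R$ becomes $R\setminus e$; the next query may depend only on outcomes of previous queries. $M(S,G)(\sigma)$ denotes the matching obtained. An edge is pendant in a graph if at least one of its endpoints has degree $1$ there. -}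

module Defs where

open import Data.Nat using (ℕ; zero; suc; _≤_)
open import Data.Fin using (Fin)
open import Data.Fin.Properties using (_≟_)
open import Data.Bool using (Bool; true; false; if_then_else_; _∧_; _∨_; not)
open import Data.List using (List; []; _∷_; length; map; _∷ʳ_)
open import Data.Nat.ListAction using (sum)
open import Data.Bool.ListAction using (any)
open import Data.List.Base using (allFin)
open import Data.List.Relation.Unary.All using (All)
open import Data.List.Relation.Unary.AllPairs using (AllPairs)
open import Data.List.Relation.Unary.Linked using (Linked)
open import Data.List.Relation.Unary.Unique.Propositional using (Unique)
open import Data.Product using (Σ; ∃; _×_; _,_; proj₁; proj₂)
open import Data.Sum using (_⊎_)
open import Data.Rational using (ℚ; 0ℚ; 1ℚ) renaming (_<_ to _<ℚ_; _≤_ to _≤ℚ_)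
open import Relation.Nullary using (¬_)
open import Relation.Nullary.Decidable using (⌊_⌋)
open import Relation.Binary.PropositionalEquality using (_≡_; _≢_)

-- A weighted graph G = (V, E, p) with V = Fin n and E = Fin m.
-- Edge e has endpoints  ends e = (u e , v e).

module _ {n m : ℕ} (ends : Fin m → Fin n × Fin n) where

  src tgt : Fin m → Fin n
  src e = proj₁ (ends e)
  tgt e = proj₂ (ends e)

  Simple : Set
  Simple = (∀ e → src e ≢ tgt e)
         × (∀ e f → ((src e ≡ src f × tgt e ≡ tgt f) ⊎ (src e ≡ tgt f × tgt e ≡ src f)) → e ≡ f)

  Adjacent : Fin n → Fin n → Set
  Adjacent x y = ∃ λ e → (src e ≡ x × tgt e ≡ y) ⊎ (src e ≡ y × tgt e ≡ x)

  Cycle : Set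
  Cycle = Σ (Fin n) λ x → Σ (List (Fin n)) λ ys →
            (3 ≤ length (x ∷ ys)) × Unique (x ∷ ys) × Linked Adjacent ((x ∷ ys) ∷ʳ x)

  Forest : Set
  Forest = ¬ Cycle

  incident : Fin n → Fin m → Bool
  incident x e = ⌊ x ≟ src e ⌋ ∨ ⌊ x ≟ tgt e ⌋

  -- edges e and f share an endpoint (note: shares e e ≡ true)
  shares : Fin m → Fin m → Bool
  shares e f = incident (src e) f ∨ incident (tgt e) f

  -- residual graph: the set of edges still present
  Residual : Set
  Residual = Fin m → Bool

  degree : Residual → Fin n → ℕ
  degree R x = sum (map (λ f → if R f ∧ incident x f then 1 else 0) (allFin m))

  Pendant : Residual → Fin m → Set
  Pendant R e = R e ≡ true × (degree R (src e) ≡ 1 ⊎ degree R (tgt e) ≡ 1)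

  NonEmpty : Residual → Set
  NonEmpty R = ∃ λ e → R e ≡ true

  -- realization: the set of edges present
  Realization : Set
  Realization = Fin m → Bool

  -- history of queries (most recent first): queried edge and outcome
  History : Set
  History = List (Fin m × Bool)

  Strategy : Set
  Strategy = History → Fin m

  record State : Set where
    constructor st
    field
      residual : Residual
      history  : History
      matching : List (Fin m)
  open State public

  initial : State
  initial = st (λ _ → true) [] []

  step : Realization → Strategy → State → State
  step σ S (st R h M) =
    if any R (allFin m)
    then (let e = S h in
          if σ e
          then st (λ f → R f ∧ not (shares e f)) ((e , true) ∷ h) (M ∷ʳ e)
          else st (λ f → R f ∧ not ⌊ f ≟ e ⌋) ((e , false) ∷ h) M)
    else st R h M

  run : Realization → Strategy → ℕ → State
  run σ S zero    = initial
  run σ S (suc k) = step σ S (run σ S k)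

  -- M(S,G)(σ): each query deletes at least the queried edge from the
  -- residual graph, so after m = |E| steps the residual graph is empty.
  M : Strategy → Realization → List (Fin m)
  M S σ = matching (run σ S m)

  ValidProb : (Fin m → ℚ) → Set
  ValidProb p = ∀ e → (0ℚ <ℚ p e) × (p e ≤ℚ 1ℚ)

  -- σ lies in the support of the distribution σ ∼ G
  InSupport : (Fin m → ℚ) → Realization → Set
  InSupport p σ = ∀ e → p e ≡ 1ℚ → σ e ≡ true

  PendantStrategy : (Fin m → ℚ) → Strategy → Set
  PendantStrategy p S = ∀ σ → InSupport p σ → ∀ k →
    NonEmpty (residual (run σ S k)) →
    Pendant (residual (run σ S k)) (S (history (run σ S k)))

  IsMatching : Realization → List (Fin m) → Set
  IsMatching σ L = Unique L × All (λ e → σ e ≡ true) L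
                 × AllPairs (λ e f → shares e f ≡ false) L

  IsMaxMatchingSize : Realization → ℕ → Set
  IsMaxMatchingSize σ k = (∃ λ L → IsMatching σ L × length L ≡ k)
                        × (∀ L → IsMatching σ L → length L ≤ k)

-- Fix a realization σ.  Say that a number ℓ is *dominated* by (R , c) if
-- ℓ ≤ c + |L'| for some matching L' of σ all of whose edges lie in the
-- residual graph R.  The run of a pendant strategy keeps the invariant
--
--   every matching L of σ has |L| dominated by (R , |M|),
--
-- where M is the matching built so far and R the residual graph.  A failed
-- query deletes an edge outside σ, which no matching of σ uses.  A
-- successful query of a pendant edge e = vw with w of degree 1 removes N(e)
-- from R; every residual edge meeting e passes through v, so at most one
-- edge of a matching L' meets e, and |M| grows by exactly one (exchange
-- lemma).  Each query removes at least one residual edge, so after m = |E|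
-- steps R is empty and the invariant reads |L| ≤ |M|.
module Submission where

open import Defs
open import Data.Nat using (ℕ; zero; suc; _+_; _∸_; _≤_; _<_; z≤n; s≤s)
open import Data.Nat.Properties
  using (≤-refl; ≤-trans; ≤-reflexive; m≤m+n; m≤n+m; +-comm; +-suc; +-identityʳ;
         +-mono-≤; +-monoʳ-≤; +-mono-<-≤; +-mono-≤-<; <⇒≤pred; pred[m∸n]≡m∸[1+n];
         n∸n≡0; n≤0⇒n≡0)
open import Data.Fin using (Fin; zero; suc)
open import Data.Fin.Properties using (_≟_)
open import Data.Bool using (Bool; true; false; T; if_then_else_; _∧_; _∨_; not)
open import Data.Bool.Properties using (∧-zeroʳ; T-≡)
import Data.Bool.Properties as Bool
open import Data.List using (List; []; _∷_; length; map; filter; _∷ʳ_)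
open import Data.List.Base using (allFin; tabulate)
open import Data.List.Properties using (map-tabulate; length-++; filter-all)
open import Data.Nat.ListAction using (sum)
open import Data.Bool.ListAction using (any)
open import Data.List.Relation.Unary.All using (All; []; _∷_)
import Data.List.Relation.Unary.All as All
import Data.List.Relation.Unary.All.Properties as All
open import Data.List.Relation.Unary.AllPairs using (AllPairs; []; _∷_)
import Data.List.Relation.Unary.AllPairs.Properties as AllPairs
import Data.List.Relation.Unary.Any as Any
open import Data.List.Relation.Unary.Any.Properties using (any⁺; any⁻)
open import Data.List.Membership.Propositional.Properties using (∈-allFin)
open import Data.Product using (∃; _×_; _,_; proj₁; proj₂)
open import Data.Sum using (_⊎_; inj₁; inj₂)
open import Data.Empty using (⊥-elim)
open import Data.Unit using (tt)
open import Function.Bundles using (Equivalence)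
open import Data.List.Membership.Propositional using (lose)
open import Function using (_∘_; id)
open import Relation.Nullary using (¬_; yes; no)
open import Relation.Nullary.Decidable using (⌊_⌋)
open import Relation.Unary using (Pred; Decidable)
open import Relation.Binary.PropositionalEquality
open import Data.Rational using (ℚ)

true≢false : true ≢ false
true≢false ()

∨-true : ∀ {a b} → a ∨ b ≡ true → a ≡ true ⊎ b ≡ true
∨-true {true}  _ = inj₁ refl
∨-true {false} p = inj₂ p

∨-introˡ : ∀ {a} b → a ≡ true → a ∨ b ≡ true
∨-introˡ b refl = refl

∨-introʳ : ∀ a {b} → b ≡ true → a ∨ b ≡ true
∨-introʳ a refl = Bool.∨-zeroʳ a

∧-trueˡ : ∀ {a b} → a ∧ b ≡ true → a ≡ true
∧-trueˡ {true} _ = refl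

∧-trueʳ : ∀ {a b} → a ∧ b ≡ true → b ≡ true
∧-trueʳ {true} p = p

∧-intro : ∀ {a b} → a ≡ true → b ≡ true → a ∧ b ≡ true
∧-intro refl refl = refl

not-true : ∀ {a} → not a ≡ true → a ≡ false
not-true {false} _ = refl

not-false : ∀ {a} → a ≡ false → not a ≡ true
not-false refl = refl

≟-refl : ∀ {k} (x : Fin k) → ⌊ x ≟ x ⌋ ≡ true
≟-refl x with x ≟ x
... | yes _ = refl
... | no x≢x = ⊥-elim (x≢x refl)

≟-true : ∀ {k} {x y : Fin k} → ⌊ x ≟ y ⌋ ≡ true → x ≡ y
≟-true {x = x} {y} p with x ≟ y
... | yes x≡y = x≡y

≟-false : ∀ {k} {x y : Fin k} → x ≢ y → ⌊ x ≟ y ⌋ ≡ false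
≟-false {x = x} {y} x≢y with x ≟ y
... | yes x≡y = ⊥-elim (x≢y x≡y)
... | no _ = refl

any-allFin-true : ∀ {k} (R : Fin k → Bool) → any R (allFin k) ≡ true → ∃ λ f → R f ≡ true
any-allFin-true R anyR with f , Rf ← Any.satisfied (any⁻ R (allFin _) (subst T (sym anyR) tt)) =
  f , Equivalence.to T-≡ Rf

any-allFin-false : ∀ {k} (R : Fin k → Bool) → any R (allFin k) ≡ false → ∀ f → R f ≡ false
any-allFin-false R anyR f with R f in Rf
... | false = refl
... | true  = ⊥-elim (subst T anyR (any⁺ R (lose (∈-allFin f) (subst T (sym Rf) tt))))

ind : Bool → ℕ
ind b = if b then 1 else 0

ind-mono : ∀ {a b} → (b ≡ true → a ≡ true) → ind b ≤ ind a
ind-mono {b = false} _ = z≤n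
ind-mono {b = true} b⇒a rewrite b⇒a refl = ≤-refl

sumFin : ∀ {k} → (Fin k → ℕ) → ℕ
sumFin {zero}  c = 0
sumFin {suc k} c = c zero + sumFin (c ∘ suc)

sum-allFin : ∀ {k} (c : Fin k → ℕ) → sum (map c (allFin k)) ≡ sumFin c
sum-allFin c = trans (cong sum (map-tabulate id c)) (sum-tabulate c)
  where
  sum-tabulate : ∀ {k} (c : Fin k → ℕ) → sum (tabulate c) ≡ sumFin c
  sum-tabulate {zero}  c = refl
  sum-tabulate {suc k} c = cong (c zero +_) (sum-tabulate (c ∘ suc))

sumFin-≥ : ∀ {k} (c : Fin k → ℕ) i → c i ≤ sumFin c
sumFin-≥ c zero    = m≤m+n (c zero) _
sumFin-≥ c (suc i) = ≤-trans (sumFin-≥ (c ∘ suc) i) (m≤n+m _ (c zero))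

sumFin-≥₂ : ∀ {k} (c : Fin k → ℕ) i j → i ≢ j → c i + c j ≤ sumFin c
sumFin-≥₂ c zero    zero    i≢j = ⊥-elim (i≢j refl)
sumFin-≥₂ c zero    (suc j) _   = +-monoʳ-≤ (c zero) (sumFin-≥ (c ∘ suc) j)
sumFin-≥₂ c (suc i) zero    _   =
  ≤-trans (≤-reflexive (+-comm (c (suc i)) (c zero))) (+-monoʳ-≤ (c zero) (sumFin-≥ (c ∘ suc) i))
sumFin-≥₂ c (suc i) (suc j) i≢j =
  ≤-trans (sumFin-≥₂ (c ∘ suc) i j (i≢j ∘ cong suc)) (m≤n+m _ (c zero))

sumFin-mono : ∀ {k} {c d : Fin k → ℕ} → (∀ i → c i ≤ d i) → sumFin c ≤ sumFin d
sumFin-mono {zero}  c≤d = z≤n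
sumFin-mono {suc k} c≤d = +-mono-≤ (c≤d zero) (sumFin-mono (c≤d ∘ suc))

sumFin-mono-< : ∀ {k} {c d : Fin k → ℕ} → (∀ i → c i ≤ d i) → ∀ i → c i < d i →
  sumFin c < sumFin d
sumFin-mono-< c≤d zero    c<d = +-mono-<-≤ c<d (sumFin-mono (c≤d ∘ suc))
sumFin-mono-< c≤d (suc i) c<d = +-mono-≤-< (c≤d zero) (sumFin-mono-< (c≤d ∘ suc) i c<d)

sumFin-01-≤ : ∀ {k} (c : Fin k → ℕ) → (∀ i → c i ≤ 1) → sumFin c ≤ k
sumFin-01-≤ {zero}  c c≤1 = z≤n
sumFin-01-≤ {suc k} c c≤1 = +-mono-≤ (c≤1 zero) (sumFin-01-≤ (c ∘ suc) (c≤1 ∘ suc))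

sumFin-zero : ∀ {k} (c : Fin k → ℕ) → (∀ i → c i ≡ 0) → sumFin c ≡ 0
sumFin-zero {zero}  c c≡0 = refl
sumFin-zero {suc k} c c≡0 rewrite c≡0 zero = sumFin-zero (c ∘ suc) (c≡0 ∘ suc)

filter-drops-at-most-one : ∀ {a p} {A : Set a} {P : Pred A p} (P? : Decidable P) {xs : List A} →
  AllPairs (λ x y → P x ⊎ P y) xs → length xs ≤ suc (length (filter P? xs))
filter-drops-at-most-one P? [] = z≤n
filter-drops-at-most-one P? {x ∷ xs} (x-or-y ∷ pairs) with P? x
... | yes px = s≤s (filter-drops-at-most-one P? pairs)
... | no ¬px rewrite filter-all P? (All.map (λ { (inj₁ px) → ⊥-elim (¬px px) ; (inj₂ py) → py }) x-or-y)
                   = ≤-refl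

module Greedy {n m : ℕ} (ends : Fin m → Fin n × Fin n) where

  touches : Fin n → Fin m → Bool
  touches = incident ends

  meets : Fin m → Fin m → Bool
  meets = shares ends

  touches-src : ∀ e → touches (src ends e) e ≡ true
  touches-src e = ∨-introˡ _ (≟-refl (src ends e))

  touches-tgt : ∀ e → touches (tgt ends e) e ≡ true
  touches-tgt e = ∨-introʳ _ (≟-refl (tgt ends e))

  meets-refl : ∀ e → meets e e ≡ true
  meets-refl e = ∨-introˡ _ (touches-src e)

  meets-via : ∀ v f g → touches v f ≡ true → touches v g ≡ true → meets f g ≡ true
  meets-via v f g vf vg with ∨-true {⌊ v ≟ src ends f ⌋} vf
  ... | inj₁ v≡src = ∨-introˡ _ (subst (λ w → touches w g ≡ true) (≟-true v≡src) vg)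
  ... | inj₂ v≡tgt = ∨-introʳ (touches (src ends f) g) (subst (λ w → touches w g ≡ true) (≟-true v≡tgt) vg)

  degree-one : ∀ (R : Residual ends) x {e f} → degree ends R x ≡ 1 →
    R e ∧ touches x e ≡ true → R f ∧ touches x f ≡ true → e ≡ f
  degree-one R x {e} {f} deg≡1 xe xf with e ≟ f
  ... | yes e≡f = e≡f
  ... | no e≢f = ⊥-elim (2≰1 (begin
      2                ≡⟨ sym (cong₂ _+_ (cong ind xe) (cong ind xf)) ⟩
      count e + count f ≤⟨ sumFin-≥₂ count e f e≢f ⟩
      sumFin count     ≡⟨ sym (sum-allFin count) ⟩
      degree ends R x  ≡⟨ deg≡1 ⟩
      1                ∎))
    where
    open Data.Nat.Properties.≤-Reasoning
    count : Fin m → ℕ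
    count g = ind (R g ∧ touches x g)
    2≰1 : ¬ (2 ≤ 1)
    2≰1 (s≤s ())

  StarCentre : Residual ends → Fin m → Fin n → Set
  StarCentre R e v = ∀ f → R f ≡ true → meets e f ≡ true → touches v f ≡ true

  pendant-star : ∀ R e → Pendant ends R e → ∃ (StarCentre R e)
  pendant-star R e (Re , inj₁ deg-src) = tgt ends e , λ f Rf e-meets-f → through-tgt f Rf (∨-true e-meets-f)
    where
    through-tgt : ∀ f → R f ≡ true → touches (src ends e) f ≡ true ⊎ touches (tgt ends e) f ≡ true →
      touches (tgt ends e) f ≡ true
    through-tgt f Rf (inj₁ at-src) = subst (λ g → touches (tgt ends e) g ≡ true)
      (degree-one R (src ends e) deg-src (∧-intro Re (touches-src e)) (∧-intro Rf at-src)) (touches-tgt e)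
    through-tgt f Rf (inj₂ at-tgt) = at-tgt
  pendant-star R e (Re , inj₂ deg-tgt) = src ends e , λ f Rf e-meets-f → through-src f Rf (∨-true e-meets-f)
    where
    through-src : ∀ f → R f ≡ true → touches (src ends e) f ≡ true ⊎ touches (tgt ends e) f ≡ true →
      touches (src ends e) f ≡ true
    through-src f Rf (inj₁ at-src) = at-src
    through-src f Rf (inj₂ at-tgt) = subst (λ g → touches (src ends e) g ≡ true)
      (degree-one R (tgt ends e) deg-tgt (∧-intro Re (touches-tgt e)) (∧-intro Rf at-tgt)) (touches-src e)

  removeNbhd : Residual ends → Fin m → Residual ends
  removeNbhd R e f = R f ∧ not (meets e f)

  removeEdge : Residual ends → Fin m → Residual ends
  removeEdge R e f = R f ∧ not ⌊ f ≟ e ⌋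

  Within : Residual ends → List (Fin m) → Set
  Within R = All (λ f → R f ≡ true)

  matching-∷ʳ : ∀ {σ M e} → IsMatching ends σ M → σ e ≡ true →
    All (λ g → meets g e ≡ false) M → IsMatching ends σ (M ∷ʳ e)
  matching-∷ʳ {e = e} (unique , inσ , disjoint) σe M-avoids-e =
      AllPairs.++⁺ unique ([] ∷ []) (All.map (λ g-avoids-e → distinct g-avoids-e ∷ []) M-avoids-e)
    , All.∷ʳ⁺ inσ σe
    , AllPairs.++⁺ disjoint ([] ∷ []) (All.map (_∷ []) M-avoids-e)
    where
    distinct : ∀ {g} → meets g e ≡ false → g ≢ e
    distinct g-avoids-e refl = true≢false (trans (sym (meets-refl e)) g-avoids-e)

  module Domination (σ : Realization ends) where

    Dominated : Residual ends → ℕ → ℕ → Set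
    Dominated R c ℓ = ∃ λ L' → IsMatching ends σ L' × Within R L' × ℓ ≤ c + length L'

    -- A failed query removes an edge outside σ, which no matching of σ uses.
    dominated-removeEdge : ∀ {R c ℓ} e → σ e ≡ false → Dominated R c ℓ → Dominated (removeEdge R e) c ℓ
    dominated-removeEdge e σe≡false (L' , matching@(_ , inσ , _) , within , bound) =
      L' , matching , All.zipWith keeps (inσ , within) , bound
      where
      keeps : ∀ {f} → σ f ≡ true × _ → _
      keeps {f} (σf , Rf) = ∧-intro Rf (not-false (≟-false λ { refl → true≢false (trans (sym σf) σe≡false) }))

    one-avoids-e : ∀ {R e v} → StarCentre R e v → ∀ f g → R f ≡ true → R g ≡ true →
      meets f g ≡ false → meets e f ≡ false ⊎ meets e g ≡ false
    one-avoids-e {e = e} {v} star f g Rf Rg f-avoids-g with meets e f in ef | meets e g in eg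
    ... | false | _     = inj₁ refl
    ... | true  | false = inj₂ refl
    ... | true  | true  = ⊥-elim (true≢false (trans
          (sym (meets-via v f g (star f Rf ef) (star g Rg eg))) f-avoids-g))

    -- Exchange lemma: removing N(e) for a pendant edge e loses at most one
    -- edge of a matching, which is paid for by adding e to the matching.
    dominated-removeNbhd : ∀ {R c ℓ} e → Pendant ends R e → Dominated R c ℓ →
      Dominated (removeNbhd R e) (suc c) ℓ
    dominated-removeNbhd {R} {c} {ℓ} e pendant (L' , (unique , inσ , disjoint) , within , bound) =
      L'' , (AllPairs.filter⁺ avoids? unique , All.filter⁺ avoids? inσ , AllPairs.filter⁺ avoids? disjoint)
          , All.zipWith (λ (Rf , f-avoids) → ∧-intro Rf (not-false f-avoids))
                        (All.filter⁺ avoids? within , All.all-filter avoids? L')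
          , (begin
              ℓ                    ≤⟨ bound ⟩
              c + length L'        ≤⟨ +-monoʳ-≤ c (filter-drops-at-most-one avoids? (pairwise within disjoint)) ⟩
              c + suc (length L'') ≡⟨ +-suc c (length L'') ⟩
              suc c + length L''   ∎)
      where
      open Data.Nat.Properties.≤-Reasoning
      avoids? : Decidable (λ f → meets e f ≡ false)
      avoids? f = meets e f Bool.≟ false
      L'' : List (Fin m)
      L'' = filter avoids? L'
      centre : Fin n
      centre = proj₁ (pendant-star R e pendant)
      star : StarCentre R e centre
      star = proj₂ (pendant-star R e pendant)
      pairwise : ∀ {L} → Within R L → AllPairs (λ f g → meets f g ≡ false) L →
        AllPairs (λ f g → meets e f ≡ false ⊎ meets e g ≡ false) L
      pairwise [] [] = []
      pairwise {f ∷ _} (Rf ∷ within) (f-avoids ∷ disjoint) =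
        All.zipWith (λ {g} (Rg , f-avoids-g) → one-avoids-e {v = centre} star f g Rf Rg f-avoids-g) (within , f-avoids)
          ∷ pairwise within disjoint

    dominated-empty : ∀ {R c ℓ} → (∀ f → R f ≡ false) → Dominated R c ℓ → ℓ ≤ c
    dominated-empty {c = c} empty ([] , _ , _ , bound) = ≤-trans bound (≤-reflexive (+-identityʳ c))
    dominated-empty empty ((f ∷ _) , _ , (Rf ∷ _) , _) = ⊥-elim (true≢false (trans (sym Rf) (empty f)))

  -- The number of edges of R; every query strictly decreases it.
  size : Residual ends → ℕ
  size R = sumFin (ind ∘ R)

  decreases : ∀ {a b} c k → a < b → b ≤ c ∸ k → a ≤ c ∸ suc k
  decreases {a} c k a<b b≤ = subst (a ≤_) (pred[m∸n]≡m∸[1+n] c k) (<⇒≤pred (≤-trans a<b b≤))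

  size-shrinks : ∀ (R R' : Residual ends) e → (∀ f → R' f ≡ true → R f ≡ true) →
    R e ≡ true → R' e ≡ false → size R' < size R
  size-shrinks R R' e R'⊆R Re R'e = sumFin-mono-< (λ f → ind-mono (R'⊆R f)) e (lt Re R'e)
    where
    lt : ∀ {a b} → a ≡ true → b ≡ false → ind b < ind a
    lt refl refl = s≤s z≤n

  size-empty : ∀ (R : Residual ends) → (∀ f → R f ≡ false) → size R ≡ 0
  size-empty R empty = sumFin-zero (ind ∘ R) (λ f → cong ind (empty f))

  size-zero : ∀ (R : Residual ends) → size R ≡ 0 → ∀ f → R f ≡ false
  size-zero R size≡0 f with R f in Rf
  ... | false = refl
  ... | true  with () ← subst (_≤ 0) (cong ind Rf) (subst (ind (R f) ≤_) size≡0 (sumFin-≥ (ind ∘ R) f))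

  module Run (σ : Realization ends) (S : Strategy ends) where
    open Domination σ

    data Step : State ends → State ends → Set where
      stop : ∀ {R h K} → (∀ f → R f ≡ false) → Step (st R h K) (st R h K)
      hit  : ∀ {R h K} → NonEmpty ends R → σ (S h) ≡ true →
        Step (st R h K) (st (removeNbhd R (S h)) ((S h , true) ∷ h) (K ∷ʳ S h))
      miss : ∀ {R h K} → NonEmpty ends R → σ (S h) ≡ false →
        Step (st R h K) (st (removeEdge R (S h)) ((S h , false) ∷ h) K)

    step-cases : ∀ s → Step s (step ends σ S s)
    step-cases (st R h K) with any R (allFin m) in anyR
    ... | false = stop (any-allFin-false R anyR)
    ... | true with σ (S h) in σe
    ...   | true  = hit (any-allFin-true R anyR) σe
    ...   | false = miss (any-allFin-true R anyR) σe

    record Invariant (s : State ends) : Set where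
      field
        is-matching : IsMatching ends σ (matching s)
        separated   : All (λ g → ∀ f → residual s f ≡ true → meets g f ≡ false) (matching s)
        dominates   : ∀ L → IsMatching ends σ L →
                      Dominated (residual s) (length (matching s)) (length L)

    PendantQuery : State ends → Set
    PendantQuery s = NonEmpty ends (residual s) → Pendant ends (residual s) (S (history s))

    invariant-initial : Invariant (initial ends)
    invariant-initial = record
      { is-matching = [] , [] , []
      ; separated   = []
      ; dominates   = λ L matching → L , matching , All.universal (λ _ → refl) L , ≤-refl
      }

    invariant-step : ∀ {s s'} → Step s s' → PendantQuery s → Invariant s → Invariant s'
    invariant-step (stop _) _ inv = inv
    invariant-step (miss _ σe) _ inv = record
      { is-matching = is-matching
      ; separated   = All.map (λ sep f → sep f ∘ ∧-trueˡ) separated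
      ; dominates   = λ L matching → dominated-removeEdge _ σe (dominates L matching)
      }
      where open Invariant inv
    invariant-step {st R h K} (hit nonempty σe) pendantQuery inv = record
      { is-matching = matching-∷ʳ is-matching σe (All.map (λ sep → sep e (proj₁ pendant)) separated)
      ; separated   = All.∷ʳ⁺ (All.map (λ sep f → sep f ∘ ∧-trueˡ) separated) (λ f → not-true ∘ ∧-trueʳ)
      ; dominates   = λ L matching → subst (λ c → Dominated (removeNbhd R e) c (length L))
                        (sym length-K∷ʳe) (dominated-removeNbhd e pendant (dominates L matching))
      }
      where
      open Invariant inv
      e : Fin m
      e = S h
      pendant : Pendant ends R e
      pendant = pendantQuery nonempty
      length-K∷ʳe : length (K ∷ʳ e) ≡ suc (length K)
      length-K∷ʳe = trans (length-++ K) (+-comm (length K) 1)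

    size-step : ∀ {s s' k} → Step s s' → PendantQuery s →
      size (residual s) ≤ m ∸ k → size (residual s') ≤ m ∸ suc k
    size-step (stop empty) _ _ = subst (_≤ _) (sym (size-empty _ empty)) z≤n
    size-step {st R h K} {k = k} (hit nonempty _) pendantQuery bound =
      decreases m k (size-shrinks R _ (S h) (λ f → ∧-trueˡ) (proj₁ (pendantQuery nonempty))
        (trans (cong (λ b → R (S h) ∧ not b) (meets-refl (S h))) (∧-zeroʳ (R (S h))))) bound
    size-step {st R h K} {k = k} (miss nonempty _) pendantQuery bound =
      decreases m k (size-shrinks R _ (S h) (λ f → ∧-trueˡ) (proj₁ (pendantQuery nonempty))
        (trans (cong (λ b → R (S h) ∧ not b) (≟-refl (S h))) (∧-zeroʳ (R (S h))))) bound

    run-invariant : (∀ k → PendantQuery (run ends σ S k)) → ∀ k →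
      Invariant (run ends σ S k) × size (residual (run ends σ S k)) ≤ m ∸ k
    run-invariant pendantQuery zero = invariant-initial , sumFin-01-≤ (λ _ → 1) (λ _ → ≤-refl)
    run-invariant pendantQuery (suc k) =
      invariant-step cases (pendantQuery k) inv , size-step cases (pendantQuery k) bound
      where
      cases = step-cases (run ends σ S k)
      inv = proj₁ (run-invariant pendantQuery k)
      bound = proj₂ (run-invariant pendantQuery k)

    -- After m steps R is empty, so the invariant bounds every matching by |K|.
    greedy-optimal : (∀ k → PendantQuery (run ends σ S k)) →
      IsMaxMatchingSize ends σ (length (M ends S σ))
    greedy-optimal pendantQuery =
      (M ends S σ , is-matching , refl) , λ L matching → dominated-empty empty (dominates L matching)
      where
      final = run-invariant pendantQuery m
      open Invariant (proj₁ final)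
      empty : ∀ f → residual (run ends σ S m) f ≡ false
      empty = size-zero _ (n≤0⇒n≡0 (subst (size (residual (run ends σ S m)) ≤_) (n∸n≡0 m) (proj₂ final)))

lemma2 : {n m : ℕ} (ends : Fin m → Fin n × Fin n) (p : Fin m → ℚ) →
    Simple ends → Forest ends → ValidProb ends p →
    (S : Strategy ends) → PendantStrategy ends p S →
    (σ : Realization ends) → InSupport ends p σ →
    IsMaxMatchingSize ends σ (length (M ends S σ))
lemma2 ends p _ _ _ S pendantStrategy σ inSupport =
  Greedy.Run.greedy-optimal ends σ S (pendantStrategy σ inSupport)
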